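{- Let $\mathbf{a}=(a_1,\ldots,a_n)$ be a finite word of positive integers and let $c\in\mathbb{N}$ with $c\ge2$. Then for any $b\in\mathbb{N}$, $$\mathcal{L}\big(I_{n+2}(0;a_1,\ldots,a_n,c,b)\big)\ge\mathcal{L}\big(I_{n+3}(0;a_1,\ldots,a_n,c-1,1,b)\big).$$
   Context: $\mathcal{L}$ is Lebesgue measure on $\mathbb{R}$. For $b_0\in\mathbb{Z}$ and positive integers $b_1,\ldots,b_k$, the fundamental interval $I_k(b_0;b_1,\ldots,b_k)$ is the set of $x\in\mathbb{R}$ whose continued fraction expansion $x=[a_0(x);a_1(x),\ldots]$ satisfies $a_i(x)=b_i$ for $0\le i\le k$; it is the interval with endpoints $b_0+p_k/q_k$ and $b_0+(p_k+p_{k-1})/(q_k+q_{k-1})$, where $p_j/q_j=[0;b_1,\ldots,b_j]$ in lowest terms. -}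

module Defs where

open import Data.Nat using (ℕ; zero; suc; _+_; _*_)
open import Data.Integer using (ℤ; +_)
open import Data.Product using (_×_; _,_)
open import Data.List using (List; foldl)
import Data.Rational as ℚ
open ℚ using (ℚ)

-- Convergent data of [0; b₁, …, b_k]:
-- returns ((p_k , q_k) , (p_{k-1} , q_{k-1})) via the standard recurrence
-- p_j = b_j p_{j-1} + p_{j-2}, q_j = b_j q_{j-1} + q_{j-2},
-- with p_{-1} = 1, q_{-1} = 0, p_0 = 0, q_0 = 1.
convStep : (ℕ × ℕ) × (ℕ × ℕ) → ℕ → (ℕ × ℕ) × (ℕ × ℕ)
convStep ((p , q) , (p' , q')) a = ((a * p + p' , a * q + q') , (p , q))

convergents : List ℕ → (ℕ × ℕ) × (ℕ × ℕ)
convergents = foldl convStep ((0 , 1) , (1 , 0))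

-- the rational p/q; denominators are positive for words of positive
-- integers, the zero-denominator clause is only a totality guard
frac : ℕ → ℕ → ℚ
frac p zero    = ℚ.0ℚ
frac p (suc d) = (+ p) ℚ./ suc d

leftEnd : ℤ → List ℕ → ℚ
leftEnd b₀ bs with convergents bs
... | ((p , q) , (p' , q')) = ℚ._+_ (b₀ ℚ./ 1) (frac p q)

rightEnd : ℤ → List ℕ → ℚ
rightEnd b₀ bs with convergents bs
... | ((p , q) , (p' , q')) = ℚ._+_ (b₀ ℚ./ 1) (frac (p + p') (q + q'))

measureI : ℤ → List ℕ → ℚ
measureI b₀ bs = ℚ.∣ rightEnd b₀ bs ℚ.- leftEnd b₀ bs ∣

{-# OPTIONS --safe #-}
-- Because consecutive convergents satisfy p' q − p q' = ±1, the interval I(0; bs) has length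
-- 1 / (q (q + q')), where q and q' are the last two denominators of the word bs.
-- Let q and q' be the last two denominators of a. Since [… , c − 1, 1] = [… , c], the words
-- a (c − 1) 1 and a c end in the same convergent, with denominator Q = c q + q'; the previous
-- denominator is (c − 1) q + q' ≥ q for the first word but only q for the second. Appending b
-- then gives the first word the larger denominators b Q + (c − 1) q + q' ≥ b Q + q, hence the
-- shorter interval.
module Submission where

open import Defs
open import Data.Nat using (ℕ; suc; _+_; _*_; _≤_; _∸_; NonZero; z≤n; s≤s)
import Data.Nat.Properties as ℕ
open import Data.Nat.Tactic.RingSolver using (solve-∀)
open import Data.Integer using (ℤ; +_)
import Data.Integer as ℤ
import Data.Integer.Properties as ℤ
import Data.Integer.Tactic.RingSolver as ℤ-Solver
open import Data.List using (List; _∷_; []; _++_; foldl)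
open import Data.List.Properties using (foldl-++)
open import Data.List.Relation.Unary.All using (All; _∷_; [])
open import Data.List.Relation.Unary.All.Properties using (++⁺)
open import Data.Product using (_×_; _,_; proj₁; proj₂)
open import Relation.Binary.PropositionalEquality
import Data.Rational as ℚ
import Data.Rational.Properties as ℚ
import Data.Rational.Unnormalised as ℚᵘ
open ℚᵘ using (mkℚᵘ; *≤*)
import Data.Rational.Unnormalised.Properties as ℚᵘ

Convergents : Set
Convergents = (ℕ × ℕ) × (ℕ × ℕ)

denominator : Convergents → ℕ
denominator ((_ , q) , _) = q

determinant : Convergents → ℤ
determinant ((p , q) , (p' , q')) = + p' ℤ.* + q ℤ.- + p ℤ.* + q'

Unimodular : Convergents → Set
Unimodular C = ℤ.∣ determinant C ∣ ≡ 1

pos-*-+ : ∀ a x y → + (a * x + y) ≡ + a ℤ.* + x ℤ.+ + y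
pos-*-+ a x y = trans (ℤ.pos-+ (a * x) y) (cong (ℤ._+ + y) (ℤ.pos-* a x))

determinant-convStep : ∀ C a → determinant (convStep C a) ≡ ℤ.- determinant C
determinant-convStep ((p , q) , (p' , q')) a = begin
  + p ℤ.* + (a * q + q') ℤ.- + (a * p + p') ℤ.* + q
    ≡⟨ cong₂ (λ x y → + p ℤ.* x ℤ.- y ℤ.* + q) (pos-*-+ a q q') (pos-*-+ a p p') ⟩
  + p ℤ.* (+ a ℤ.* + q ℤ.+ + q') ℤ.- (+ a ℤ.* + p ℤ.+ + p') ℤ.* + q
    ≡⟨ swap-sign (+ p) (+ q) (+ p') (+ q') (+ a) ⟩
  ℤ.- (+ p' ℤ.* + q ℤ.- + p ℤ.* + q') ∎
  where
  open ≡-Reasoning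
  swap-sign : ∀ p q p' q' a → p ℤ.* (a ℤ.* q ℤ.+ q') ℤ.- (a ℤ.* p ℤ.+ p') ℤ.* q
                             ≡ ℤ.- (p' ℤ.* q ℤ.- p ℤ.* q')
  swap-sign = ℤ-Solver.solve-∀

foldl-convStep-unimodular : ∀ C bs → Unimodular C → Unimodular (foldl convStep C bs)
foldl-convStep-unimodular C []       u = u
foldl-convStep-unimodular C (a ∷ bs) u = foldl-convStep-unimodular (convStep C a) bs (begin
  ℤ.∣ determinant (convStep C a) ∣  ≡⟨ cong ℤ.∣_∣ (determinant-convStep C a) ⟩
  ℤ.∣ ℤ.- determinant C ∣          ≡⟨ ℤ.∣-i∣≡∣i∣ (determinant C) ⟩
  ℤ.∣ determinant C ∣              ≡⟨ u ⟩
  1                                ∎)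
  where open ≡-Reasoning

convergents-unimodular : ∀ bs → Unimodular (convergents bs)
convergents-unimodular bs = foldl-convStep-unimodular _ bs refl

foldl-convStep-denominator-pos : ∀ {C bs} → All (1 ≤_) bs → 1 ≤ denominator C →
                                 1 ≤ denominator (foldl convStep C bs)
foldl-convStep-denominator-pos []                  1≤q = 1≤q
foldl-convStep-denominator-pos {(_ , q) , (_ , q')} (1≤a ∷ 1≤bs) 1≤q =
  foldl-convStep-denominator-pos 1≤bs (ℕ.≤-trans (ℕ.*-mono-≤ 1≤a 1≤q) (ℕ.m≤m+n _ q'))

convergents-denominator-pos : ∀ {bs} → All (1 ≤_) bs → 1 ≤ denominator (convergents bs)
convergents-denominator-pos 1≤bs = foldl-convStep-denominator-pos 1≤bs ℕ.≤-refl

convergents-++ : ∀ as bs → convergents (as ++ bs) ≡ foldl convStep (convergents as) bs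
convergents-++ as bs = foldl-++ convStep _ as bs

intervalLength : Convergents → ℚ.ℚ
intervalLength ((p , q) , (p' , q')) =
  ℚ.∣ (ℚ.0ℚ ℚ.+ frac (p + p') (q + q')) ℚ.- (ℚ.0ℚ ℚ.+ frac p q) ∣

measureI-convergents : ∀ bs → measureI (+ 0) bs ≡ intervalLength (convergents bs)
measureI-convergents bs with convergents bs
... | (p , q) , (p' , q') = refl

lengthDenominator : Convergents → ℕ
lengthDenominator ((_ , q) , (_ , q')) = (q + q') * q

mediant-difference : ∀ p k p' q' →
  mkℚᵘ (+ (p + p')) (k + q') ℚᵘ.- mkℚᵘ (+ p) k
    ≡ determinant ((p , suc k) , (p' , q')) ℚᵘ./ lengthDenominator ((p , suc k) , (p' , q'))
mediant-difference p k p' q' = cong (ℚᵘ._/ lengthDenominator ((p , suc k) , (p' , q'))) (begin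
  + (p + p') ℤ.* + suc k ℤ.+ ℤ.- + p ℤ.* + (suc k + q')
    ≡⟨ cong₂ (λ x y → x ℤ.* + suc k ℤ.+ ℤ.- + p ℤ.* y) (ℤ.pos-+ p p') (ℤ.pos-+ (suc k) q') ⟩
  (+ p ℤ.+ + p') ℤ.* + suc k ℤ.+ ℤ.- + p ℤ.* (+ suc k ℤ.+ + q')
    ≡⟨ cross (+ p) (+ suc k) (+ p') (+ q') ⟩
  + p' ℤ.* + suc k ℤ.- + p ℤ.* + q' ∎)
  where
  open ≡-Reasoning
  cross : ∀ p q p' q' → (p ℤ.+ p') ℤ.* q ℤ.+ ℤ.- p ℤ.* (q ℤ.+ q') ≡ p' ℤ.* q ℤ.- p ℤ.* q'
  cross = ℤ-Solver.solve-∀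

intervalLength-≃ : ∀ p k p' q' → let C = (p , suc k) , (p' , q') in
  Unimodular C → ℚ.toℚᵘ (intervalLength C) ℚᵘ.≃ + 1 ℚᵘ./ lengthDenominator C
intervalLength-≃ p k p' q' u = begin
  ℚ.toℚᵘ (intervalLength C)
    ≈⟨ ℚ.toℚᵘ-homo-∣-∣ _ ⟩
  ℚᵘ.∣ ℚ.toℚᵘ ((ℚ.0ℚ ℚ.+ R) ℚ.- (ℚ.0ℚ ℚ.+ L)) ∣
    ≡⟨ cong (λ x → ℚᵘ.∣ ℚ.toℚᵘ x ∣) (cong₂ ℚ._-_ (ℚ.+-identityˡ R) (ℚ.+-identityˡ L)) ⟩
  ℚᵘ.∣ ℚ.toℚᵘ (R ℚ.- L) ∣
    ≈⟨ ℚᵘ.∣-∣-cong (ℚ.toℚᵘ-homo-+ R (ℚ.- L)) ⟩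
  ℚᵘ.∣ ℚ.toℚᵘ R ℚᵘ.+ ℚ.toℚᵘ (ℚ.- L) ∣
    ≈⟨ ℚᵘ.∣-∣-cong (ℚᵘ.+-cong (ℚ.toℚᵘ-fromℚᵘ (mkℚᵘ (+ (p + p')) (k + q')))
                               (ℚᵘ.≃-trans (ℚ.toℚᵘ-homo‿- L) (ℚᵘ.-‿cong (ℚ.toℚᵘ-fromℚᵘ (mkℚᵘ (+ p) k))))) ⟩
  ℚᵘ.∣ mkℚᵘ (+ (p + p')) (k + q') ℚᵘ.- mkℚᵘ (+ p) k ∣
    ≡⟨ cong ℚᵘ.∣_∣ (mediant-difference p k p' q') ⟩
  ℚᵘ.∣ determinant C ℚᵘ./ lengthDenominator C ∣
    ≡⟨ cong (λ n → + n ℚᵘ./ lengthDenominator C) u ⟩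
  + 1 ℚᵘ./ lengthDenominator C ∎
  where
  open ℚᵘ.≃-Reasoning
  C : Convergents
  C = (p , suc k) , (p' , q')
  R L : ℚ.ℚ
  R = frac (p + p') (suc k + q')
  L = frac p (suc k)

1/-antimono-≤ : ∀ m n .{{_ : NonZero m}} .{{_ : NonZero n}} → m ≤ n → + 1 ℚᵘ./ n ℚᵘ.≤ + 1 ℚᵘ./ m
1/-antimono-≤ m@(suc _) n@(suc _) m≤n =
  *≤* (subst₂ ℤ._≤_ (sym (ℤ.*-identityˡ _)) (sym (ℤ.*-identityˡ _)) (ℤ.+≤+ m≤n))

intervalLength-antitone : ∀ {C₁ C₂} → Unimodular C₁ → Unimodular C₂ →
  1 ≤ denominator C₁ → 1 ≤ denominator C₂ →
  lengthDenominator C₂ ≤ lengthDenominator C₁ → intervalLength C₁ ℚ.≤ intervalLength C₂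
intervalLength-antitone {(p₁ , suc k₁) , (p₁' , q₁')} {(p₂ , suc k₂) , (p₂' , q₂')} u₁ u₂ (s≤s z≤n) (s≤s z≤n) D₂≤D₁ =
  ℚ.toℚᵘ-cancel-≤ (begin
    ℚ.toℚᵘ (intervalLength C₁)      ≃⟨ intervalLength-≃ p₁ k₁ p₁' q₁' u₁ ⟩
    + 1 ℚᵘ./ lengthDenominator C₁   ≤⟨ 1/-antimono-≤ (lengthDenominator C₂) (lengthDenominator C₁) D₂≤D₁ ⟩
    + 1 ℚᵘ./ lengthDenominator C₂   ≃⟨ ℚᵘ.≃-sym (intervalLength-≃ p₂ k₂ p₂' q₂' u₂) ⟩
    ℚ.toℚᵘ (intervalLength C₂)      ∎)
  where
  open ℚᵘ.≤-Reasoning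
  C₁ C₂ : Convergents
  C₁ = (p₁ , suc k₁) , (p₁' , q₁')
  C₂ = (p₂ , suc k₂) , (p₂' , q₂')

convStep-one : ∀ C d → proj₁ (convStep (convStep C d) 1) ≡ proj₁ (convStep C (suc d))
convStep-one ((p , q) , (p' , q')) d = cong₂ _,_ (merge d p p') (merge d q q')
  where
  merge : ∀ d x y → 1 * (d * x + y) + x ≡ suc d * x + y
  merge = solve-∀

lengthDenominator-convStep-mono : ∀ x y y' b → proj₂ y ≤ proj₂ y' →
  lengthDenominator (convStep (x , y) b) ≤ lengthDenominator (convStep (x , y') b)
lengthDenominator-convStep-mono (_ , q) (_ , r) (_ , r') b r≤r' =
  ℕ.*-mono-≤ (ℕ.+-monoˡ-≤ q bq+r≤bq+r') bq+r≤bq+r'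
  where
  bq+r≤bq+r' : b * q + r ≤ b * q + r'
  bq+r≤bq+r' = ℕ.+-monoʳ-≤ (b * q) r≤r'

lengthDenominator-split : ∀ C {d} b → 1 ≤ d →
  lengthDenominator (foldl convStep C (suc d ∷ b ∷ []))
    ≤ lengthDenominator (foldl convStep C (d ∷ 1 ∷ b ∷ []))
lengthDenominator-split C@((p , q) , (p' , q')) {d@(suc d₀)} b (s≤s z≤n) = begin
  lengthDenominator (convStep (x , (p , q)) b)
    ≤⟨ lengthDenominator-convStep-mono x (p , q) (proj₁ (convStep C d)) b q≤dq+q' ⟩
  lengthDenominator (convStep (x , proj₁ (convStep C d)) b)
    ≡⟨ cong (λ x → lengthDenominator (convStep (x , proj₁ (convStep C d)) b)) (convStep-one C d) ⟨
  lengthDenominator (convStep (convStep (convStep C d) 1) b) ∎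
  where
  open ℕ.≤-Reasoning
  x : ℕ × ℕ
  x = proj₁ (convStep C (suc d))
  q≤dq+q' : q ≤ d * q + q'
  q≤dq+q' = ℕ.≤-trans (ℕ.m≤m+n q (d₀ * q)) (ℕ.m≤m+n (d * q) q')

lemma2p9 : (as : List ℕ) → All (λ a → 1 ≤ a) as →
           (c : ℕ) → 2 ≤ c → (b : ℕ) → 1 ≤ b →
           measureI (+ 0) (as ++ (c ∸ 1) ∷ 1 ∷ b ∷ [])
             ℚ.≤ measureI (+ 0) (as ++ c ∷ b ∷ [])
lemma2p9 as 1≤as (suc d) (s≤s 1≤d) b 1≤b = begin
  measureI (+ 0) w₁                ≡⟨ measureI-convergents w₁ ⟩
  intervalLength (convergents w₁)  ≤⟨ intervalLength-antitone
                                        (convergents-unimodular w₁) (convergents-unimodular w₂)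
                                        (convergents-denominator-pos 1≤w₁) (convergents-denominator-pos 1≤w₂)
                                        D₂≤D₁ ⟩
  intervalLength (convergents w₂)  ≡⟨ measureI-convergents w₂ ⟨
  measureI (+ 0) w₂                ∎
  where
  open ℚ.≤-Reasoning
  w₁ w₂ : List ℕ
  w₁ = as ++ d ∷ 1 ∷ b ∷ []
  w₂ = as ++ suc d ∷ b ∷ []
  1≤w₁ : All (1 ≤_) w₁
  1≤w₁ = ++⁺ 1≤as (1≤d ∷ ℕ.≤-refl ∷ 1≤b ∷ [])
  1≤w₂ : All (1 ≤_) w₂
  1≤w₂ = ++⁺ 1≤as (s≤s z≤n ∷ 1≤b ∷ [])
  D₂≤D₁ : lengthDenominator (convergents w₂) ≤ lengthDenominator (convergents w₁)
  D₂≤D₁ rewrite convergents-++ as (suc d ∷ b ∷ []) | convergents-++ as (d ∷ 1 ∷ b ∷ []) =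
    lengthDenominator-split (convergents as) b 1≤d
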